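{- For every integer $\kappa\geq 0$, there exist infinitely many graphs $G$ with vertex connectivity $\kappa$ such that, with $n=|V(G)|$, $\mathrm{th}_{\mathrm{H}}(G)>\lceil 2\sqrt{n-\kappa}+\kappa-1\rceil$.
   Context: All graphs are finite, simple and undirected; $N(v)$ is the open neighborhood of $v$. Vertices are colored blue or white. Under the hopping color change rule, a blue vertex $v$ may force a white vertex $w$ (not necessarily adjacent to $v$) to become blue provided $v$ has not previously performed a force and every vertex of $N(v)$ is blue. Starting from an initial blue set $B\subseteq V(G)$, a chronological list of forces is a sequence of valid forces performed one at a time until no further force is possible; its unordered set of forces is a set of forces of $B$. $B$ is a hopping forcing set if some chronological list turns every vertex blue. For a set of forces $\mathcal F$ of $B$, put $\mathcal F^{(0)}=B$ and, for $t>0$, let $\mathcal F^{(t)}$ be the set of vertices $w$ for which there is a force $v\to w$ in $\mathcal F$ with $v\in\bigcup_{i<t}\mathcal F^{(i)}$ that is a valid hopping force when exactly the vertices of $\bigcup_{i<t}\mathcal F^{(i)}$ are blue. $\mathrm{pt}_{\mathrm{H}}(G;\mathcal F)$ is the least $t$ with $\bigcup_{i\le t}\mathcal F^{(i)}=V(G)$, and $\mathrm{pt}_{\mathrm{H}}(G;B)$ is the minimum of $\mathrm{pt}_{\mathrm{H}}(G;\mathcal F)$ over sets of forces $\mathcal F$ of $B$ ($\infty$ if $B$ is not a hopping forcing set). The hopping throttling number is $\mathrm{th}_{\mathrm{H}}(G)=\min_{B\subseteq V(G)}\big(|B|+\mathrm{pt}_{\mathrm{H}}(G;B)\big)$. 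-}

module Defs where

open import Data.Nat using (ℕ; zero; suc; _+_; _*_; _≤_)
open import Data.Bool using (Bool; true; false)
open import Data.Fin using (Fin)
open import Data.Fin.Subset using (Subset; _∈_; _∉_; _∪_; ⁅_⁆; ∣_∣; ∁)
open import Data.List using (List; []; _∷_)
import Data.List.Membership.Propositional as L
open import Data.Product using (Σ; _×_; _,_)
open import Data.Sum using (_⊎_)
open import Relation.Nullary using (¬_)
open import Relation.Binary.PropositionalEquality using (_≡_)

record Graph (n : ℕ) : Set where
  field
    Adj   : Fin n → Fin n → Bool
    sym   : ∀ x y → Adj x y ≡ Adj y x
    irrefl : ∀ x → Adj x x ≡ false
open Graph public

module _ {n : ℕ} (G : Graph n) where

  NbhdIn : Subset n → Fin n → Set
  NbhdIn S v = ∀ u → Adj G v u ≡ true → u ∈ S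

  -- v → w is a valid hopping force when S is the blue set and U is the
  -- list of vertices that have already performed a force.
  ValidForce : Subset n → List (Fin n) → Fin n → Fin n → Set
  ValidForce S U v w = (v ∈ S) × (w ∉ S) × (¬ (v L.∈ U)) × NbhdIn S v

  -- Run S U fs : performing the forces fs in order, starting with blue set S
  -- and already-used forcing vertices U, is valid, and at the end no further
  -- force is possible.
  data Run : Subset n → List (Fin n) → List (Fin n × Fin n) → Set where
    done : ∀ {S U} → (∀ v w → ¬ ValidForce S U v w) → Run S U []
    step : ∀ {S U v w fs} → ValidForce S U v w →
           Run (S ∪ ⁅ w ⁆) (v ∷ U) fs → Run S U ((v , w) ∷ fs)

  -- fs is a chronological list of forces of B (its set of forces is the set
  -- of pairs occurring in fs).
  Chrono : Subset n → List (Fin n × Fin n) → Set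
  Chrono B fs = Run B [] fs

  -- Propagation: Cum B F t x  means  x ∈ F^(0) ∪ … ∪ F^(t)

  Cum : Subset n → List (Fin n × Fin n) → ℕ → Fin n → Set
  Cum B F zero x = x ∈ B
  Cum B F (suc t) x =
    Cum B F t x ⊎
    Σ (Fin n) λ v → ((v , x) L.∈ F) × Cum B F t v × ¬ Cum B F t x
                    × (∀ u → Adj G v u ≡ true → Cum B F t u)

  AllBlueAt : Subset n → List (Fin n × Fin n) → ℕ → Set
  AllBlueAt B F t = ∀ x → Cum B F t x

  IsPtF : Subset n → List (Fin n × Fin n) → ℕ → Set
  IsPtF B F t = AllBlueAt B F t × (∀ s → AllBlueAt B F s → t ≤ s)

  -- pt_H(G; B) = t  (minimum over sets of forces of B; no such t if ∞)
  IsPtB : Subset n → ℕ → Set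
  IsPtB B t =
    (Σ (List (Fin n × Fin n)) λ fs → Chrono B fs × IsPtF B fs t) ×
    (∀ fs s → Chrono B fs → IsPtF B fs s → t ≤ s)

  IsThH : ℕ → Set
  IsThH k =
    (Σ (Subset n) λ B → Σ ℕ λ t → IsPtB B t × ∣ B ∣ + t ≡ k) ×
    (∀ B t → IsPtB B t → k ≤ ∣ B ∣ + t)

  data Reach (S : Subset n) (x : Fin n) : Fin n → Set where
    here : x ∉ S → Reach S x x
    there : ∀ {y z} → Reach S x y → Adj G y z ≡ true → z ∉ S → Reach S x z

  Separates : Subset n → Set
  Separates S =
    (Σ (Fin n) λ x → Σ (Fin n) λ y → x ∉ S × y ∉ S × ¬ Reach S x y)
    ⊎ (∣ ∁ S ∣ ≤ 1)

  IsConnectivity : ℕ → Set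
  IsConnectivity k =
    (Σ (Subset n) λ S → Separates S × ∣ S ∣ ≡ k) ×
    (∀ S → Separates S → k ≤ ∣ S ∣)

-- c = ⌈ 2 √m ⌉  (least natural number c with 4m ≤ c²)
IsCeil2Sqrt : ℕ → ℕ → Set
IsCeil2Sqrt m c = (4 * m ≤ c * c) × (∀ d → 4 * m ≤ d * d → c ≤ d)

-- G is the join of κ universal "hub" vertices with two disjoint a-cliques.
-- Deleting the hubs disconnects G, and every smaller vertex set misses a hub,
-- which keeps the rest connected; so κ(G) = κ.  The first hopping force
-- needs a blue vertex whose closed neighbourhood is blue, and every closed
-- neighbourhood has at least κ + a vertices, so |B| + pt ≥ κ + a + 1
-- whenever B ≠ V(G).  Equality holds for B = hubs ∪ one clique, which
-- forces the other clique in a single round along a perfect matching.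
-- With a = 2m² we get n − κ = (2m)², so ⌈2√(n − κ)⌉ = 4m ≤ a.
module Submission where

open import Defs
open import Data.Nat using (ℕ; _+_; _∸_; _≤_; _<_)
open import Data.Product using (Σ; _×_)

open import Data.Nat using (zero; suc; pred; _*_; z≤n; s≤s)
open import Data.Nat.Properties
open import Data.Nat.Solver using (module +-*-Solver)
open import Data.Bool using (Bool; true; false; not; _∧_; if_then_else_)
import Data.Bool.Properties as Bool
open import Data.Fin using (Fin; zero; _↑ˡ_; _↑ʳ_; splitAt; join)
import Data.Fin.Properties as Fin
open import Data.Fin.Subset using (Subset; _∈_; _∉_; _∪_; ⁅_⁆; ∣_∣; ∁; _⊆_; ⊤)
open import Data.Fin.Subset.Properties
  using (∣⊤∣≡n; ∣⊥∣≡0; p⊆q⇒∣p∣≤∣q∣; p⊆p∪q; x∈p∪q⁺; x∈p∪q⁻; x∈⁅x⁆; x∈⁅y⁆⇒x≡y; ∣∁p∣≡n∸∣p∣; _∈?_)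
open import Data.Vec using (Vec; []; _∷_; _++_; lookup; replicate; map)
open import Data.Vec.Properties using ([]=⇒lookup; lookup⇒[]=; lookup-map; lookup-++ˡ; lookup-++ʳ; lookup-replicate; map-++; map-replicate)
open import Data.List using (List; []; _∷_; allFin)
import Data.List as List
import Data.List.Membership.Propositional as L
open import Data.List.Membership.Propositional.Properties using (∈-map⁺; ∈-allFin)
open import Data.List.Relation.Unary.Unique.Propositional using (Unique)
open import Data.List.Relation.Unary.Unique.Propositional.Properties using (allFin⁺)
open import Data.List.Relation.Unary.AllPairs using (_∷_)
open import Data.List.Relation.Unary.Any using (here; there)
import Data.List.Relation.Unary.All as All
open import Data.Product using (∃; _,_)
open import Data.Sum using (_⊎_; inj₁; inj₂; fromInj₂)
open import Data.Empty using (⊥-elim)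
open import Function.Definitions using (Injective)
open import Relation.Nullary using (¬_; yes; no; does; contradiction)
open import Relation.Nullary.Decidable using (_→-dec_)
open import Relation.Binary.PropositionalEquality as ≡ using (_≡_; _≢_; refl; trans; cong; subst)

∣p++q∣≡∣p∣+∣q∣ : ∀ {m k} (p : Subset m) (q : Subset k) → ∣ p ++ q ∣ ≡ ∣ p ∣ + ∣ q ∣
∣p++q∣≡∣p∣+∣q∣ []          q = refl
∣p++q∣≡∣p∣+∣q∣ (true ∷ p)  q = cong suc (∣p++q∣≡∣p∣+∣q∣ p q)
∣p++q∣≡∣p∣+∣q∣ (false ∷ p) q = ∣p++q∣≡∣p∣+∣q∣ p q

∣replicate∣ : ∀ m b → ∣ replicate m b ∣ ≡ (if b then m else 0)
∣replicate∣ m true  = ∣⊤∣≡n m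
∣replicate∣ m false = ∣⊥∣≡0 m

module _ {n : ℕ} where

  ⊤⊆⇒n≤∣p∣ : {p : Subset n} → (∀ x → x ∈ p) → n ≤ ∣ p ∣
  ⊤⊆⇒n≤∣p∣ {p} all∈p = subst (_≤ ∣ p ∣) (∣⊤∣≡n n) (p⊆q⇒∣p∣≤∣q∣ {p = ⊤} (λ {x} _ → all∈p x))

  all∈⊎∃∉ : (p : Subset n) → (∀ x → x ∈ p) ⊎ ∃ λ x → x ∉ p
  all∈⊎∃∉ p with Fin.all? (_∈? p)
  ... | yes all∈p = inj₁ all∈p
  ... | no ¬all∈p = inj₂ (Fin.¬∀⟶∃¬ n _ (_∈? p) ¬all∈p)

module _ {n : ℕ} (G : Graph n) where

  nbhdIn⊎outsideNeighbour : ∀ B v → NbhdIn G B v ⊎ ∃ λ u → Adj G v u ≡ true × u ∉ B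
  nbhdIn⊎outsideNeighbour B v with Fin.all? (λ u → (Adj G v u Bool.≟ true) →-dec (u ∈? B))
  ... | yes nbhdIn = inj₁ nbhdIn
  ... | no ¬nbhdIn with Fin.¬∀⟶∃¬ n _ (λ u → (Adj G v u Bool.≟ true) →-dec (u ∈? B)) ¬nbhdIn
  ...   | u , ¬[vu⇒u∈B] with Adj G v u Bool.≟ true
  ...     | yes vu = inj₂ (u , vu , λ u∈B → ¬[vu⇒u∈B] (λ _ → u∈B))
  ...     | no ¬vu = ⊥-elim (¬[vu⇒u∈B] (λ vu → contradiction vu ¬vu))

  InitialForcer : Subset n → Set
  InitialForcer B = ∃ λ v → v ∈ B × NbhdIn G B v

  -- If the forcer v of x is initially blue but N(v) ⊄ B, some u ∈ N(v) is blue
  -- at time t without being in B, and we recurse on u.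
  cum⇒∈⊎initialForcer : ∀ {B F} t {x} → Cum G B F t x → x ∈ B ⊎ InitialForcer B
  cum⇒∈⊎initialForcer zero    x∈B       = inj₁ x∈B
  cum⇒∈⊎initialForcer (suc t) (inj₁ cx) = cum⇒∈⊎initialForcer t cx
  cum⇒∈⊎initialForcer {B} (suc t) (inj₂ (v , _ , cv , _ , nbv)) with cum⇒∈⊎initialForcer t cv
  ... | inj₂ forcer = inj₂ forcer
  ... | inj₁ v∈B with nbhdIn⊎outsideNeighbour B v
  ...   | inj₁ nbhdIn = inj₂ (v , v∈B , nbhdIn)
  ...   | inj₂ (u , vu , u∉B) =
          inj₂ (fromInj₂ (λ u∈B → contradiction u∈B u∉B) (cum⇒∈⊎initialForcer t (nbv u vu)))

  allBlue⇒full⊎initialForcer : ∀ {B F t} → AllBlueAt G B F t → (∀ x → x ∈ B) ⊎ InitialForcer B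
  allBlue⇒full⊎initialForcer {B} {t = t} allBlue with all∈⊎∃∉ B
  ... | inj₁ full         = inj₁ full
  ... | inj₂ (x , x∉B) =
        inj₂ (fromInj₂ (λ x∈B → contradiction x∈B x∉B) (cum⇒∈⊎initialForcer t (allBlue x)))

  ptB-lowerBound : ∀ d → d < n → (∀ B v → v ∈ B → NbhdIn G B v → d ≤ ∣ B ∣) →
                   ∀ B t → IsPtB G B t → suc d ≤ ∣ B ∣ + t
  ptB-lowerBound d d<n _ B zero ((_ , _ , allBlue , _) , _) =
    ≤-trans d<n (≤-trans (⊤⊆⇒n≤∣p∣ allBlue) (m≤m+n ∣ B ∣ 0))
  ptB-lowerBound d d<n closedNbhd B (suc t) ((_ , _ , allBlue , _) , _)
    with allBlue⇒full⊎initialForcer allBlue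
  ... | inj₁ full = ≤-trans d<n (≤-trans (⊤⊆⇒n≤∣p∣ full) (m≤m+n ∣ B ∣ (suc t)))
  ... | inj₂ (v , v∈B , nbv) =
        subst (suc d ≤_) (≡.sym (+-suc ∣ B ∣ t)) (s≤s (≤-trans (closedNbhd B v v∈B nbv) (m≤m+n ∣ B ∣ t)))

  Universal : Fin n → Set
  Universal u = ∀ x → u ≢ x → Adj G u x ≡ true

  reach-∉ : ∀ {S x y} → Reach G S x y → y ∉ S
  reach-∉ (here x∉S)       = x∉S
  reach-∉ (there _ _ z∉S) = z∉S

  reach-universal : ∀ {S u x} → Universal u → u ∉ S → x ∉ S → Reach G S x u
  reach-universal {u = u} {x} univ u∉S x∉S with u Fin.≟ x
  ... | yes refl = here x∉S
  ... | no u≢x   = there (here x∉S) (trans (sym G x u) (univ x u≢x)) u∉S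

  reach-via-universal : ∀ {S u x y} → Universal u → u ∉ S → x ∉ S → y ∉ S → Reach G S x y
  reach-via-universal {u = u} {y = y} univ u∉S x∉S y∉S with u Fin.≟ y
  ... | yes refl = reach-universal univ u∉S x∉S
  ... | no u≢y   = there (reach-universal univ u∉S x∉S) (univ y u≢y) y∉S

  universals⊆separator : ∀ {H S} → (∀ u → u ∈ H → Universal u) → Separates G S → H ⊆ S ⊎ ∣ ∁ S ∣ ≤ 1
  universals⊆separator univ (inj₂ small) = inj₂ small
  universals⊆separator {H} {S} univ (inj₁ (x , y , x∉S , y∉S , ¬x⇝y)) = inj₁ H⊆S
    where
    H⊆S : H ⊆ S
    H⊆S {u} u∈H with u ∈? S
    ... | yes u∈S = u∈S
    ... | no u∉S  = contradiction (reach-via-universal (univ u u∈H) u∉S x∉S y∉S) ¬x⇝y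

  universals≤separator : ∀ {H S} → (∀ u → u ∈ H → Universal u) → ∣ H ∣ < n → Separates G S → ∣ H ∣ ≤ ∣ S ∣
  universals≤separator {S = S} univ ∣H∣<n sep with universals⊆separator univ sep
  ... | inj₁ H⊆S  = p⊆q⇒∣p∣≤∣q∣ H⊆S
  ... | inj₂ small = ≤-pred (≤-trans ∣H∣<n (≤-trans (m≤n+m∸n n ∣ S ∣) (≤-trans
                      (+-monoʳ-≤ ∣ S ∣ (subst (_≤ 1) (∣∁p∣≡n∸∣p∣ S) small)) (≤-reflexive (+-comm ∣ S ∣ 1)))))

module PerfectForcing {n k : ℕ} (G : Graph n) (B : Subset n) (forcer target : Fin (suc k) → Fin n)
  (forcer-injective : Injective _≡_ _≡_ forcer) (target-injective : Injective _≡_ _≡_ target)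
  (forcer∈B : ∀ j → forcer j ∈ B) (forcer-nbhdIn : ∀ j → NbhdIn G B (forcer j))
  (target∉B : ∀ j → target j ∉ B) (∉B⇒target : ∀ x → x ∉ B → ∃ λ j → x ≡ target j) where

  forces : List (Fin (suc k)) → List (Fin n × Fin n)
  forces = List.map (λ j → forcer j , target j)

  -- S and U are the blue set and the spent forcers after a prefix of the
  -- forces has been performed; js indexes the forces still to come.
  run : ∀ S U js → Unique js → B ⊆ S →
        (∀ j → j L.∈ js → target j ∉ S) → (∀ j → ¬ j L.∈ js → target j ∈ S) →
        (∀ j → j L.∈ js → ¬ forcer j L.∈ U) → Run G S U (forces js)
  run S U [] _ B⊆S _ forcedTargets∈S _ = done (λ v w (_ , w∉S , _) → w∉S (all∈S w))
    where
    all∈S : ∀ w → w ∈ S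
    all∈S w with w ∈? B
    ... | yes w∈B = B⊆S w∈B
    ... | no w∉B with ∉B⇒target w w∉B
    ...   | j , refl = forcedTargets∈S j (λ ())
  run S U (j ∷ js) (j∉js ∷ uniqueJs) B⊆S pending∉S forced∈S unused =
    step (B⊆S (forcer∈B j) , pending∉S j (here refl) , unused j (here refl) , λ u vu → B⊆S (forcer-nbhdIn j u vu))
      (run (S ∪ ⁅ target j ⁆) (forcer j ∷ U) js uniqueJs (λ x∈B → p⊆p∪q _ (B⊆S x∈B)) pending∉S′ forced∈S′ unused′)
    where
    pending∉S′ : ∀ i → i L.∈ js → target i ∉ S ∪ ⁅ target j ⁆
    pending∉S′ i i∈js ti∈S′ with x∈p∪q⁻ S ⁅ target j ⁆ ti∈S′
    ... | inj₁ ti∈S   = pending∉S i (there i∈js) ti∈S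
    ... | inj₂ ti≡tj = All.lookup j∉js i∈js (≡.sym (target-injective (x∈⁅y⁆⇒x≡y (target j) ti≡tj)))
    forced∈S′ : ∀ i → ¬ i L.∈ js → target i ∈ S ∪ ⁅ target j ⁆
    forced∈S′ i i∉js with i Fin.≟ j
    ... | yes refl = x∈p∪q⁺ (inj₂ (x∈⁅x⁆ (target i)))
    ... | no i≢j   = x∈p∪q⁺ (inj₁ (forced∈S i λ { (here i≡j) → i≢j i≡j ; (there i∈js) → i∉js i∈js }))
    unused′ : ∀ i → i L.∈ js → ¬ forcer i L.∈ forcer j ∷ U
    unused′ i i∈js (here fi≡fj)  = All.lookup j∉js i∈js (≡.sym (forcer-injective fi≡fj))
    unused′ i i∈js (there fi∈U) = unused i (there i∈js) fi∈U

  chrono : Chrono G B (forces (allFin (suc k)))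
  chrono = run B [] (allFin (suc k)) (allFin⁺ (suc k)) (λ x∈B → x∈B) (λ j _ → target∉B j)
             (λ j j∉ → contradiction (∈-allFin j) j∉) (λ _ _ ())

  allBlueAt1 : AllBlueAt G B (forces (allFin (suc k))) 1
  allBlueAt1 x with x ∈? B
  ... | yes x∈B = inj₁ x∈B
  ... | no x∉B with ∉B⇒target x x∉B
  ...   | j , refl = inj₂ (forcer j , ∈-map⁺ _ (∈-allFin j) , forcer∈B j , target∉B j , forcer-nbhdIn j)

  1≤pt : ∀ F s → AllBlueAt G B F s → 1 ≤ s
  1≤pt F zero    allBlue = contradiction (allBlue (target zero)) (target∉B zero)
  1≤pt F (suc s) _       = s≤s z≤n

  ptB≡1 : IsPtB G B 1
  ptB≡1 = (forces (allFin (suc k)) , chrono , allBlueAt1 , 1≤pt _) , λ F s _ (allBlue , _) → 1≤pt F s allBlue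

ceil2Sqrt-square : ∀ r → IsCeil2Sqrt (r * r) (2 * r)
ceil2Sqrt-square r = ≤-reflexive 4r²≡[2r]² , minimal
  where
  4r²≡[2r]² : 4 * (r * r) ≡ 2 * r * (2 * r)
  4r²≡[2r]² = solve 1 (λ x → con 4 :* (x :* x) := (con 2 :* x) :* (con 2 :* x)) refl r
    where open +-*-Solver
  minimal : ∀ d → 4 * (r * r) ≤ d * d → 2 * r ≤ d
  minimal d 4r²≤d² = ≮⇒≥ λ d<2r → <⇒≱ (*-mono-< d<2r d<2r) (subst (_≤ d * d) 4r²≡[2r]² 4r²≤d²)

data Side : Set where
  hub left right : Side

linked : Side → Side → Bool
linked left  right = false
linked right left  = false
linked _     _     = true

linked-sym : ∀ s t → linked s t ≡ linked t s
linked-sym hub   hub   = refl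
linked-sym hub   left  = refl
linked-sym hub   right = refl
linked-sym left  hub   = refl
linked-sym left  left  = refl
linked-sym left  right = refl
linked-sym right hub   = refl
linked-sym right left  = refl
linked-sym right right = refl

isHub : Side → Bool
isHub hub = true
isHub _   = false

linked-offHub : ∀ s t → isHub s ≡ false → isHub t ≡ false → linked s t ≡ true → s ≡ t
linked-offHub left  left  _ _ _ = refl
linked-offHub right right _ _ _ = refl
linked-offHub hub   _     () _ _
linked-offHub _     hub   _ () _
linked-offHub left  right _ _ ()
linked-offHub right left  _ _ ()

module HubbedCliques (κ a′ : ℕ) where

  a : ℕ
  a = suc a′

  n : ℕ
  n = κ + (a + a)

  hubAt : Fin κ → Fin n
  hubAt i = i ↑ˡ (a + a)

  leftAt rightAt : Fin a → Fin n
  leftAt  j = κ ↑ʳ (j ↑ˡ a)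
  rightAt j = κ ↑ʳ (a ↑ʳ j)

  data Position : Fin n → Set where
    at-hub   : ∀ i → Position (hubAt i)
    at-left  : ∀ j → Position (leftAt j)
    at-right : ∀ j → Position (rightAt j)

  position : ∀ x → Position x
  position x = subst Position (Fin.join-splitAt κ (a + a) x) (outer (splitAt κ x))
    where
    outer : ∀ s → Position (join κ (a + a) s)
    outer (inj₁ i) = at-hub i
    outer (inj₂ y) = subst (λ z → Position (κ ↑ʳ z)) (Fin.join-splitAt a a y) (inner (splitAt a y))
      where
      inner : ∀ s → Position (κ ↑ʳ join a a s)
      inner (inj₁ j) = at-left j
      inner (inj₂ j) = at-right j

  sides : Vec Side n
  sides = replicate κ hub ++ (replicate a left ++ replicate a right)

  side : Fin n → Side
  side = lookup sides

  side-hubAt : ∀ i → side (hubAt i) ≡ hub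
  side-hubAt i = trans (lookup-++ˡ (replicate κ hub) _ i) (lookup-replicate i hub)

  side-leftAt : ∀ j → side (leftAt j) ≡ left
  side-leftAt j = begin
    side (leftAt j)                                         ≡⟨ lookup-++ʳ (replicate κ hub) _ (j ↑ˡ a) ⟩
    lookup (replicate a left ++ replicate a right) (j ↑ˡ a) ≡⟨ lookup-++ˡ (replicate a left) _ j ⟩
    lookup (replicate a left) j                             ≡⟨ lookup-replicate j left ⟩
    left                                                    ∎
    where open ≡.≡-Reasoning

  side-rightAt : ∀ j → side (rightAt j) ≡ right
  side-rightAt j = begin
    side (rightAt j)                                         ≡⟨ lookup-++ʳ (replicate κ hub) _ (a ↑ʳ j) ⟩
    lookup (replicate a left ++ replicate a right) (a ↑ʳ j)  ≡⟨ lookup-++ʳ (replicate a left) _ j ⟩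
    lookup (replicate a right) j                             ≡⟨ lookup-replicate j right ⟩
    right                                                    ∎
    where open ≡.≡-Reasoning

  adjacent : Fin n → Fin n → Bool
  adjacent x y = not (does (x Fin.≟ y)) ∧ linked (side x) (side y)

  adjacent-sym : ∀ x y → adjacent x y ≡ adjacent y x
  adjacent-sym x y with x Fin.≟ y | y Fin.≟ x
  ... | yes _   | yes _   = refl
  ... | yes x≡y | no y≢x  = contradiction (≡.sym x≡y) y≢x
  ... | no x≢y  | yes y≡x = contradiction (≡.sym y≡x) x≢y
  ... | no _    | no _    = linked-sym (side x) (side y)

  adjacent-irrefl : ∀ x → adjacent x x ≡ false
  adjacent-irrefl x with x Fin.≟ x
  ... | yes _  = refl
  ... | no x≢x = contradiction refl x≢x

  graph : Graph n
  graph = record { Adj = adjacent ; sym = adjacent-sym ; irrefl = adjacent-irrefl }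

  adjacent⇒linked : ∀ x y → adjacent x y ≡ true → linked (side x) (side y) ≡ true
  adjacent⇒linked x y xy with x Fin.≟ y
  ... | no _ = xy

  linked⇒adjacent : ∀ x y → x ≢ y → linked (side x) (side y) ≡ true → adjacent x y ≡ true
  linked⇒adjacent x y x≢y linked-xy with x Fin.≟ y
  ... | yes x≡y = contradiction x≡y x≢y
  ... | no _    = linked-xy

  region : (Side → Bool) → Subset n
  region P = map P sides

  ∈region⁺ : ∀ {P x} → P (side x) ≡ true → x ∈ region P
  ∈region⁺ {P} {x} Px = lookup⇒[]= x (region P) (trans (lookup-map x P sides) Px)

  ∈region⁻ : ∀ {P x} → x ∈ region P → P (side x) ≡ true
  ∈region⁻ {P} {x} x∈P = trans (≡.sym (lookup-map x P sides)) ([]=⇒lookup x∈P)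

  ∣region∣ : ∀ P → ∣ region P ∣ ≡ (if P hub then κ else 0) + ((if P left then a else 0) + (if P right then a else 0))
  ∣region∣ P = begin
    ∣ map P sides ∣
      ≡⟨ cong ∣_∣ (map-++ P (replicate κ hub) _) ⟩
    ∣ map P (replicate κ hub) ++ map P (replicate a left ++ replicate a right) ∣
      ≡⟨ cong (λ q → ∣ map P (replicate κ hub) ++ q ∣) (map-++ P (replicate a left) _) ⟩
    ∣ map P (replicate κ hub) ++ (map P (replicate a left) ++ map P (replicate a right)) ∣
      ≡⟨ ∣p++q∣≡∣p∣+∣q∣ (map P (replicate κ hub)) _ ⟩
    ∣ map P (replicate κ hub) ∣ + ∣ map P (replicate a left) ++ map P (replicate a right) ∣
      ≡⟨ cong (∣ map P (replicate κ hub) ∣ +_) (∣p++q∣≡∣p∣+∣q∣ (map P (replicate a left)) _) ⟩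
    ∣ map P (replicate κ hub) ∣ + (∣ map P (replicate a left) ∣ + ∣ map P (replicate a right) ∣)
      ≡⟨ ≡.cong₂ _+_ (count hub κ) (≡.cong₂ _+_ (count left a) (count right a)) ⟩
    _ ∎
    where
    open ≡.≡-Reasoning
    count : ∀ s m → ∣ map P (replicate m s) ∣ ≡ (if P s then m else 0)
    count s m = trans (cong ∣_∣ (map-replicate P s m)) (∣replicate∣ m (P s))

  ∉region : ∀ {P x} → P (side x) ≡ false → x ∉ region P
  ∉region Px≡false x∈P = Bool.not-¬ Px≡false (∈region⁻ x∈P)

  hubs : Subset n
  hubs = region isHub

  ∣hubs∣ : ∣ hubs ∣ ≡ κ
  ∣hubs∣ = trans (∣region∣ isHub) (+-identityʳ κ)

  hub-universal : ∀ u → u ∈ hubs → Universal graph u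
  hub-universal u u∈hubs x u≢x = linked⇒adjacent u x u≢x (hub-linked (side u) (side x) (∈region⁻ u∈hubs))
    where
    hub-linked : ∀ s t → isHub s ≡ true → linked s t ≡ true
    hub-linked hub t _ = refl

  side-reach : ∀ {x y} → Reach graph hubs x y → side x ≡ side y
  side-reach (here _) = refl
  side-reach (there {y} {z} x⇝y yz z∉hubs) =
    trans (side-reach x⇝y)
      (linked-offHub (side y) (side z) (offHub (reach-∉ graph x⇝y)) (offHub z∉hubs) (adjacent⇒linked y z yz))
    where
    offHub : ∀ {x} → x ∉ hubs → isHub (side x) ≡ false
    offHub x∉hubs = Bool.¬-not (λ isHub → x∉hubs (∈region⁺ isHub))

  hubs-separate : Separates graph hubs
  hubs-separate = inj₁ (leftAt zero , rightAt zero ,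
    ∉region (cong isHub (side-leftAt zero)) , ∉region (cong isHub (side-rightAt zero)) ,
    λ l⇝r → left≢right (trans (≡.sym (side-leftAt zero)) (trans (side-reach l⇝r) (side-rightAt zero))))
    where
    left≢right : left ≢ right
    left≢right ()

  connectivity : IsConnectivity graph κ
  connectivity = (hubs , hubs-separate , ∣hubs∣) ,
    λ S sep → subst (_≤ ∣ S ∣) ∣hubs∣ (universals≤separator graph hub-universal ∣hubs∣<n sep)
    where
    ∣hubs∣<n : ∣ hubs ∣ < n
    ∣hubs∣<n = subst (_< n) (≡.sym ∣hubs∣) (m<m+n κ (s≤s z≤n))

  closedNbhd⊆ : ∀ {B v} → v ∈ B → NbhdIn graph B v → region (linked (side v)) ⊆ B
  closedNbhd⊆ {v = v} v∈B nbv {u} u∈region with v Fin.≟ u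
  ... | yes refl = v∈B
  ... | no v≢u   = nbv u (linked⇒adjacent v u v≢u (∈region⁻ u∈region))

  κ+a≤∣closedNbhd∣ : ∀ s → κ + a ≤ ∣ region (linked s) ∣
  κ+a≤∣closedNbhd∣ hub   = subst (κ + a ≤_) (≡.sym (∣region∣ (linked hub))) (+-monoʳ-≤ κ (m≤m+n a a))
  κ+a≤∣closedNbhd∣ left  = ≤-reflexive (≡.sym (trans (∣region∣ (linked left)) (cong (κ +_) (+-identityʳ a))))
  κ+a≤∣closedNbhd∣ right = ≤-reflexive (≡.sym (∣region∣ (linked right)))

  hubsAndLeft : Subset n
  hubsAndLeft = region (linked left)

  ∉hubsAndLeft⇒right : ∀ x → x ∉ hubsAndLeft → ∃ λ j → x ≡ rightAt j
  ∉hubsAndLeft⇒right x x∉ with position x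
  ... | at-hub i   = contradiction (∈region⁺ (cong (linked left) (side-hubAt i))) x∉
  ... | at-left j  = contradiction (∈region⁺ (cong (linked left) (side-leftAt j))) x∉
  ... | at-right j = j , refl

  open PerfectForcing graph hubsAndLeft leftAt rightAt
    (λ e → Fin.↑ˡ-injective a _ _ (Fin.↑ʳ-injective κ _ _ e))
    (λ e → Fin.↑ʳ-injective a _ _ (Fin.↑ʳ-injective κ _ _ e))
    (λ j → ∈region⁺ (cong (linked left) (side-leftAt j)))
    (λ j u ju → ∈region⁺ (subst (λ s → linked s (side u) ≡ true) (side-leftAt j) (adjacent⇒linked _ u ju)))
    (λ j → ∉region (cong (linked left) (side-rightAt j)))
    ∉hubsAndLeft⇒right

  throttling : IsThH graph (suc (κ + a))
  throttling = (hubsAndLeft , 1 , ptB≡1 , ∣hubsAndLeft∣+1) ,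
    ptB-lowerBound graph (κ + a) (+-monoʳ-< κ (m<m+n a (s≤s z≤n)))
      (λ B v v∈B nbv → ≤-trans (κ+a≤∣closedNbhd∣ (side v)) (p⊆q⇒∣p∣≤∣q∣ (closedNbhd⊆ v∈B nbv)))
    where
    ∣hubsAndLeft∣+1 : ∣ hubsAndLeft ∣ + 1 ≡ suc (κ + a)
    ∣hubsAndLeft∣+1 = trans (+-comm _ 1) (cong suc (trans (∣region∣ (linked left)) (cong (κ +_) (+-identityʳ a))))

[2m]²≡2m²+2m² : ∀ m → 2 * m * (2 * m) ≡ 2 * (m * m) + 2 * (m * m)
[2m]²≡2m²+2m² = solve 1 (λ m → (con 2 :* m) :* (con 2 :* m) := con 2 :* (m :* m) :+ con 2 :* (m :* m)) refl
  where open +-*-Solver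

4m≤2m² : ∀ m → 2 ≤ m → 2 * (2 * m) ≤ 2 * (m * m)
4m≤2m² m 2≤m = *-monoʳ-≤ 2 (*-monoˡ-≤ m 2≤m)

proposition3p9 : (κ N : ℕ) →
    Σ ℕ λ n → N ≤ n × Σ (Graph n) λ G → IsConnectivity G κ ×
      Σ ℕ λ th → IsThH G th ×
        Σ ℕ λ c → IsCeil2Sqrt (n ∸ κ) c × c + κ < th + 1
proposition3p9 κ N =
  n , N≤n , graph , connectivity , suc (κ + a) , throttling , 2 * r , ceil , c+κ<th+1
  where
  m r : ℕ
  m = 2 + N
  r = 2 * m
  -- Since m = 2 + N, the term 2 * (m * m) reduces to suc (pred (2 * (m * m))),
  -- so a is 2m² definitionally.
  open HubbedCliques κ (pred (2 * (m * m)))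
  N≤n : N ≤ n
  N≤n = ≤-trans (m≤n+m N 2) (≤-trans (m≤m*n m m) (≤-trans (m≤m+n (m * m) _)
          (≤-trans (m≤m+n a a) (m≤n+m (a + a) κ))))
  ceil : IsCeil2Sqrt (n ∸ κ) (2 * r)
  ceil = subst (λ k → IsCeil2Sqrt k (2 * r)) (trans ([2m]²≡2m²+2m² m) (≡.sym (m+n∸m≡n κ (a + a))))
           (ceil2Sqrt-square r)
  c+κ<th+1 : 2 * r + κ < suc (κ + a) + 1
  c+κ<th+1 = s≤s (≤-trans (≤-trans (+-monoˡ-≤ κ (4m≤2m² m (s≤s (s≤s z≤n)))) (≤-reflexive (+-comm a κ)))
               (m≤m+n (κ + a) 1))
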